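{- Let $\tau\in P_n$. Then there exists $w\in\widetilde S^0_{2n}$ such that $g_\tau=wg_0w^{ -1}$, $\ell(w)=\binom n2-c(\tau)$, and $\ell(g_\tau)=2\ell(w)$.
   Context: $P_n$ is the set of perfect matchings of $[2n]$ (fixed-point-free involutions); $c(\tau)$ is the number of pairs $\{a,c\},\{b,d\}\in\tau$ with $a<b<c<d$. For $\tau\in P_n$, $g_\tau(i)=\tau(i)$ if $i<\tau(i)$ and $g_\tau(i)=\tau(i)+2n$ if $i>\tau(i)$ for $i\in[2n]$, extended by $g_\tau(i+2n)=g_\tau(i)+2n$; $g_0(i)=i+n$ for all $i$. $\widetilde S^0_{2n}$ is the group of bijections $w:\mathbb Z\to\mathbb Z$ with $w(i+2n)=w(i)+2n$ and $\sum_{i=1}^{2n}(w(i)-i)=0$. The length of a bijection $f$ with $f(i+2n)=f(i)+2n$ is $\ell(f)=\#\{(i,j):i\in[2n],j\in\mathbb Z,i<j,f(i)>f(j)\}$. -}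

module Defs where

open import Data.Nat as ℕ using (ℕ; zero; suc)
open import Data.Nat.Combinatorics using (_C_)
open import Data.Integer as ℤ using (ℤ; +_)
open import Data.Integer.DivMod using (_%ℕ_; _/ℕ_; n%ℕd<d)
open import Data.Fin as Fin using (Fin; toℕ; fromℕ<)
open import Data.Fin.Properties using () renaming (_<?_ to _<ᶠ?_)
open import Data.List using (List; allFin; map; foldr; length)
open import Data.Nat.ListAction using (sum)
open import Data.List.Membership.Propositional using (_∈_)
open import Data.List.Relation.Unary.Unique.Propositional using (Unique)
open import Data.Product using (Σ; _×_; _,_)
open import Data.Bool using (Bool; true; false; _∧_; if_then_else_)
open import Relation.Nullary using (¬_)
open import Relation.Nullary.Decidable using (⌊_⌋)
open import Relation.Binary.PropositionalEquality using (_≡_)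
open import Function.Bundles using (_⇔_)

-- Positions are 0-based: p : Fin (2 * n) stands for the element p+1 of [2n].

record PerfectMatching (n : ℕ) : Set where
  field
    τ      : Fin (2 ℕ.* n) → Fin (2 ℕ.* n)
    invol  : ∀ i → τ (τ i) ≡ i
    noFix  : ∀ i → ¬ (τ i ≡ i)
open PerfectMatching public

bool→ℕ : Bool → ℕ
bool→ℕ true  = 1
bool→ℕ false = 0

-- c(τ): number of crossings {a,c},{b,d} with a<b<c<d; each crossing is
-- counted once via its (a,b), with c = τ a and d = τ b.
crossings : ∀ {n} → PerfectMatching n → ℕ
crossings {n} m =
  sum (map (λ a → sum (map (λ b → bool→ℕ (cross a b)) (allFin (2 ℕ.* n))))
           (allFin (2 ℕ.* n)))
  where
  t = τ m
  cross : Fin (2 ℕ.* n) → Fin (2 ℕ.* n) → Bool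
  cross a b = ⌊ a <ᶠ? b ⌋ ∧ ⌊ b <ᶠ? t a ⌋ ∧ ⌊ t a <ᶠ? t b ⌋

gBase : ∀ {n} → PerfectMatching n → Fin (2 ℕ.* n) → ℤ
gBase {n} m i =
  if ⌊ i <ᶠ? τ m i ⌋
  then + (suc (toℕ (τ m i)))
  else + (suc (toℕ (τ m i)) ℕ.+ 2 ℕ.* n)

-- g_τ : ℤ → ℤ, extended by g(i + 2n) = g(i) + 2n.
-- (For n = 0 the set [0] is empty; we set g = id, which is irrelevant.)
g : ∀ {n} → PerfectMatching n → ℤ → ℤ
g {zero}  m x = x
g {suc k} m x =
  let N = 2 ℕ.* suc k
      y = x ℤ.- ℤ.1ℤ
      r = y %ℕ N
      q = y /ℕ N
  in gBase m (fromℕ< (n%ℕd<d y N)) ℤ.+ q ℤ.* + N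

g₀ : ℕ → ℤ → ℤ
g₀ n x = x ℤ.+ + n

displacementSum : ℕ → (ℤ → ℤ) → ℤ
displacementSum n w =
  foldr ℤ._+_ ℤ.0ℤ (map (λ (i : Fin (2 ℕ.* n)) → w (+ suc (toℕ i)) ℤ.- + suc (toℕ i))
                        (allFin (2 ℕ.* n)))

record AffineS0 (n : ℕ) : Set where
  field
    w        : ℤ → ℤ
    winv     : ℤ → ℤ
    w∘winv   : ∀ x → w (winv x) ≡ x
    winv∘w   : ∀ x → winv (w x) ≡ x
    periodic : ∀ x → w (x ℤ.+ + (2 ℕ.* n)) ≡ w x ℤ.+ + (2 ℕ.* n)
    sumZero  : displacementSum n w ≡ ℤ.0ℤ
open AffineS0 public

Inversion : ℕ → (ℤ → ℤ) → ℕ × ℤ → Set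
Inversion n f (i , j) =
  (1 ℕ.≤ i) × (i ℕ.≤ 2 ℕ.* n) × (+ i ℤ.< j) × (f j ℤ.< f (+ i))

HasLength : ℕ → (ℤ → ℤ) → ℕ → Set
HasLength n f k =
  Σ (List (ℕ × ℤ)) λ L →
    Unique L × (∀ p → (p ∈ L) ⇔ Inversion n f p) × (length L ≡ k)

module Submission where

-- Label the openers of the arcs (a < τ a) 0 … n−1 from left to right and the
-- closer of the arc labelled k by n + k.  This bijection ρ of [2n], with
-- inverse σ, extends periodically to w; since partners are labelled r and
-- r + n (mod 2n), g_τ ∘ w = w ∘ g₀.  For a periodic extension whose values
-- on [2n] spread by at most 4n, every inversion lies within two periods, so
-- its length is a finite count over pairs of positions (InversionCount).
-- Classifying pairs of arcs as nested, disjoint or crossing (ArcOrder, Arcs)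
-- gives ℓ(w) = #nested + #disjoint and ℓ(g_τ) = 2 #nested + 2 #disjoint,
-- while C(n,2) counts all pairs of arcs and c(τ) the crossing ones.

open import Defs
open import Data.Nat as ℕ using (ℕ; zero; suc; NonZero; _≤_; _<_; _<?_; s≤s; z≤n)
import Data.Nat.Properties as ℕP
open import Data.Fin as Fin using (Fin; toℕ; fromℕ<)
import Data.Fin.Properties as FinP
open import Data.Product using (Σ; _×_; _,_; proj₁; proj₂)
open import Data.Sum using (_⊎_; inj₁; inj₂)
open import Data.Empty using (⊥-elim)
open import Relation.Nullary using (Dec; yes; no; ¬_)
open import Relation.Nullary.Decidable using (_×-dec_; _⊎-dec_; ⌊_⌋)
open import Relation.Unary using (Decidable)
open import Relation.Binary using (tri<; tri≈; tri>)
open import Relation.Binary.PropositionalEquality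
open import Algebra.Properties.CommutativeMonoid.Sum ℕP.+-0-commutativeMonoid
  using (sum; sum-syntax; sum-cong-≗; ∑-distrib-+; ∑-comm; sum-permute)
open ≡-Reasoning

module Counting where

  open import Data.Nat using (_+_; _*_)
  open import Data.Nat.Combinatorics using (_C_; nCk+nC[k+1]≡[n+1]C[k+1]; nC1≡n)
  open import Data.Nat.ListAction using () renaming (sum to listSum)
  open import Data.Fin using (_↑ˡ_; _↑ʳ_; punchOut)
  open import Data.Fin.Permutation using (permutation)
  open import Data.List using (List; _++_; map; filter; length; tabulate; allFin; cartesianProductWith)
  import Data.List.Properties as ListP

  𝕀 : ∀ {a} {A : Set a} → Dec A → ℕ
  𝕀 (yes _) = 1
  𝕀 (no _)  = 0

  𝕀-yes : ∀ {a} {A : Set a} (d : Dec A) → A → 𝕀 d ≡ 1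
  𝕀-yes (yes _) _ = refl
  𝕀-yes (no ¬a) a = ⊥-elim (¬a a)

  𝕀-no : ∀ {a} {A : Set a} (d : Dec A) → ¬ A → 𝕀 d ≡ 0
  𝕀-no (yes a) ¬a = ⊥-elim (¬a a)
  𝕀-no (no _)  _  = refl

  𝕀-cong : ∀ {a b} {A : Set a} {B : Set b} → (A → B) → (B → A) →
           (d : Dec A) (e : Dec B) → 𝕀 d ≡ 𝕀 e
  𝕀-cong f g (yes a) e = sym (𝕀-yes e (f a))
  𝕀-cong f g (no ¬a) e = sym (𝕀-no e (λ b → ¬a (g b)))

  𝕀-mono : ∀ {a b} {A : Set a} {B : Set b} → (A → B) → (d : Dec A) (e : Dec B) → 𝕀 d ≤ 𝕀 e
  𝕀-mono f (yes a) e = ℕP.≤-reflexive (sym (𝕀-yes e (f a)))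
  𝕀-mono f (no _)  e = z≤n

  ∑-const : ∀ N c → ∑[ i < N ] c ≡ N * c
  ∑-const zero    c = refl
  ∑-const (suc N) c = cong (c +_) (∑-const N c)

  ∑-zero : ∀ N → ∑[ i < N ] 0 ≡ 0
  ∑-zero N = trans (∑-const N 0) (ℕP.*-zeroʳ N)

  ∑-mono : ∀ {N} {f g : Fin N → ℕ} → (∀ i → f i ≤ g i) → sum f ≤ sum g
  ∑-mono {zero}  le = z≤n
  ∑-mono {suc N} le = ℕP.+-mono-≤ (le Fin.zero) (∑-mono (λ i → le (Fin.suc i)))

  ∑-reindex : ∀ {N} (f : Fin N → ℕ) (π π⁻¹ : Fin N → Fin N) →
              (∀ i → π (π⁻¹ i) ≡ i) → (∀ i → π⁻¹ (π i) ≡ i) →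
              ∑[ i < N ] f (π i) ≡ sum f
  ∑-reindex f π π⁻¹ r l = sym (sum-permute f (permutation π π⁻¹ r l))

  ∑-delta : ∀ {N} (j : Fin N) → ∑[ i < N ] 𝕀 (i Fin.≟ j) ≡ 1
  ∑-delta {suc N} Fin.zero =
    cong suc (trans (sum-cong-≗ {N} (λ i → 𝕀-no (Fin.suc i Fin.≟ Fin.zero) λ ())) (∑-zero N))
  ∑-delta {suc N} (Fin.suc j) =
    trans (sum-cong-≗ {N} (λ i → 𝕀-cong FinP.suc-injective (cong Fin.suc) (Fin.suc i Fin.≟ Fin.suc j) _))
          (∑-delta j)

  pairs-count : ∀ {N} {p : Fin N → Set} (p? : Decidable p) →
    ∑[ a < N ] ∑[ b < N ] 𝕀 (toℕ a <? toℕ b ×-dec p? a ×-dec p? b) ≡ (∑[ a < N ] 𝕀 (p? a)) C 2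
  pairs-count {zero} p? = refl
  pairs-count {suc N} {p} p? = begin
    ∑[ b < suc N ] pair Fin.zero b + ∑[ a < N ] ∑[ b < suc N ] pair (Fin.suc a) b
      ≡⟨ cong₂ ℕ._+_ pairs-with-first (trans (sum-cong-≗ (λ a → sum-cong-≗ (pairs-after a)))
                                             (pairs-count (λ i → p? (Fin.suc i)))) ⟩
    𝕀 (p? Fin.zero) * rest + rest C 2   ≡⟨ pascal (p? Fin.zero) ⟩
    (𝕀 (p? Fin.zero) + rest) C 2        ∎
    where
    pair : Fin (suc N) → Fin (suc N) → ℕ
    pair a b = 𝕀 (toℕ a <? toℕ b ×-dec p? a ×-dec p? b)
    rest : ℕ
    rest = ∑[ b < N ] 𝕀 (p? (Fin.suc b))
    pairs-with-first : ∑[ b < suc N ] pair Fin.zero b ≡ 𝕀 (p? Fin.zero) * rest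
    pairs-with-first with p? Fin.zero
    ... | yes p0 = trans (sum-cong-≗ {N} (λ b → 𝕀-cong (λ (_ , _ , q) → q) (λ q → s≤s z≤n , p0 , q)
                                     (0 <? suc (toℕ b) ×-dec yes p0 ×-dec p? (Fin.suc b)) (p? (Fin.suc b))))
                         (sym (ℕP.+-identityʳ rest))
    ... | no ¬p0 = trans (sum-cong-≗ {N} (λ b → 𝕀-no (0 <? suc (toℕ b) ×-dec no ¬p0 ×-dec p? (Fin.suc b))
                                                    (λ (_ , q , _) → ¬p0 q)))
                         (∑-zero N)
    pairs-after : ∀ a b → pair (Fin.suc a) (Fin.suc b)
                        ≡ 𝕀 (toℕ a <? toℕ b ×-dec p? (Fin.suc a) ×-dec p? (Fin.suc b))
    pairs-after a b = 𝕀-cong (λ (q , r) → ℕP.≤-pred q , r) (λ (q , r) → s≤s q , r) _ _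
    pascal : (d : Dec (p Fin.zero)) → 𝕀 d * rest + rest C 2 ≡ (𝕀 d + rest) C 2
    pascal (yes _) = trans (cong (ℕ._+ rest C 2) (trans (ℕP.+-identityʳ rest) (sym (nC1≡n rest))))
                           (nCk+nC[k+1]≡[n+1]C[k+1] rest 1)
    pascal (no _)  = refl

  ∑-split : ∀ M K (f : Fin (M + K) → ℕ) →
            sum f ≡ ∑[ i < M ] f (i ↑ˡ K) + ∑[ j < K ] f (M ↑ʳ j)
  ∑-split zero    K f = refl
  ∑-split (suc M) K f = trans (cong (f Fin.zero +_) (∑-split M K (λ i → f (Fin.suc i))))
                            (sym (ℕP.+-assoc (f Fin.zero) _ _))

  module _ {A : Set} {P : A → Set} (P? : Decidable P) where

    count-tabulate : ∀ {M} (u : Fin M → A) → length (filter P? (tabulate u)) ≡ ∑[ i < M ] 𝕀 (P? (u i))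
    count-tabulate {zero}  u = refl
    count-tabulate {suc M} u with P? (u Fin.zero)
    ... | yes _ = cong suc (count-tabulate (λ i → u (Fin.suc i)))
    ... | no  _ = count-tabulate (λ i → u (Fin.suc i))

    count-product : ∀ {B C : Set} {M K} (h : B → C → A) (u : Fin M → B) (v : Fin K → C) →
      length (filter P? (cartesianProductWith h (tabulate u) (tabulate v)))
        ≡ ∑[ i < M ] ∑[ j < K ] 𝕀 (P? (h (u i) (v j)))
    count-product {M = zero}  h u v = refl
    count-product {M = suc M} {K} h u v = begin
      length (filter P? (row ++ rows))                 ≡⟨ cong length (ListP.filter-++ P? row rows) ⟩
      length (filter P? row ++ filter P? rows)         ≡⟨ ListP.length-++ (filter P? row) ⟩
      length (filter P? row) + length (filter P? rows) ≡⟨ cong₂ _+_ first-row (count-product h (λ i → u (Fin.suc i)) v) ⟩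
      ∑[ i < suc M ] ∑[ j < K ] 𝕀 (P? (h (u i) (v j))) ∎
      where
      row  = map (h (u Fin.zero)) (tabulate v)
      rows = cartesianProductWith h (tabulate (λ i → u (Fin.suc i))) (tabulate v)
      first-row : length (filter P? row) ≡ ∑[ j < K ] 𝕀 (P? (h (u Fin.zero) (v j)))
      first-row = trans (cong (λ l → length (filter P? l)) (ListP.map-tabulate v (h (u Fin.zero))))
                        (count-tabulate (λ j → h (u Fin.zero) (v j)))

  listSum-allFin : ∀ {N} (f : Fin N → ℕ) → listSum (map f (allFin N)) ≡ sum f
  listSum-allFin {N} f = trans (cong listSum (ListP.map-tabulate (λ i → i) f)) (tabulate-sum f)
    where
    tabulate-sum : ∀ {M} (g : Fin M → ℕ) → listSum (tabulate g) ≡ sum g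
    tabulate-sum {zero}  g = refl
    tabulate-sum {suc M} g = cong (g Fin.zero +_) (tabulate-sum (λ i → g (Fin.suc i)))

  injective⇒surjective : ∀ {N} (f : Fin N → Fin N) → (∀ {a b} → f a ≡ f b → a ≡ b) →
                         ∀ y → Σ (Fin N) λ x → f x ≡ y
  injective⇒surjective {suc N} f inj y with FinP.any? (λ x → f x Fin.≟ y)
  ... | yes hit = hit
  ... | no miss = ⊥-elim (ℕP.<-irrefl refl (FinP.injective⇒≤ {f = avoid} avoid-injective))
    where
    -- without a preimage of y, f would inject Fin (suc N) into Fin N
    avoid : Fin (suc N) → Fin N
    avoid x = punchOut {i = y} {j = f x} (λ y≡fx → miss (x , sym y≡fx))
    avoid-injective : ∀ {a b} → avoid a ≡ avoid b → a ≡ b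
    avoid-injective {a} {b} e =
      inj (FinP.punchOut-injective (λ y≡fa → miss (a , sym y≡fa)) (λ y≡fb → miss (b , sym y≡fb)) e)

-- Every integer is uniquely 1 + r + qN with r : Fin N
-- ("position r of period q"); a function F : Fin N → ℤ extends to ℤ by
-- x = 1 + r + qN ↦ F r + qN.  This is how g_τ is defined in Defs.
module Periodic (N : ℕ) .{{_ : NonZero N}} where

  open import Data.Integer as ℤ using (ℤ; +_; -[1+_]; _+_; _*_; _-_; -_; 0ℤ; 1ℤ)
  import Data.Integer.Properties as ℤP
  open import Data.Integer.DivMod using (_%ℕ_; _/ℕ_; n%ℕd<d; a≡a%ℕn+[a/ℕn]*n)
  open import Data.Integer.Tactic.RingSolver using (solve-∀)

  at : Fin N → ℤ → ℤ
  at r q = + suc (toℕ r) + q * + N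

  residue : ℤ → Fin N
  residue x = fromℕ< (n%ℕd<d (x - 1ℤ) N)

  period : ℤ → ℤ
  period x = (x - 1ℤ) /ℕ N

  -- definitionally the shape of g in Defs
  ext : (Fin N → ℤ) → ℤ → ℤ
  ext F x = F (residue x) + period x * + N

  decompose : ∀ x → x ≡ at (residue x) (period x)
  decompose x = begin
    x                                             ≡⟨ x≡1+[x-1] x ⟩
    1ℤ + (x - 1ℤ)                                 ≡⟨ cong (λ z → 1ℤ + z) (a≡a%ℕn+[a/ℕn]*n (x - 1ℤ) N) ⟩
    1ℤ + (+ ((x - 1ℤ) %ℕ N) + period x * + N)     ≡⟨ cong (λ r → 1ℤ + (+ r + period x * + N))
                                                         (sym (FinP.toℕ-fromℕ< _)) ⟩
    1ℤ + (+ toℕ (residue x) + period x * + N)     ≡⟨ sym (ℤP.+-assoc 1ℤ (+ toℕ (residue x)) (period x * + N)) ⟩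
    at (residue x) (period x)                     ∎
    where x≡1+[x-1] : ∀ x → x ≡ 1ℤ + (x - 1ℤ)
          x≡1+[x-1] = solve-∀

  swap-sides : ∀ a b d → a ≡ b + d * + N → b ≡ a + (- d) * + N
  swap-sides a b d e = begin
    b                              ≡⟨ cancel b d (+ N) ⟩
    (b + d * + N) + (- d) * + N    ≡⟨ cong (_+ (- d) * + N) (sym e) ⟩
    a + (- d) * + N                ∎
    where cancel : ∀ b d n → b ≡ (b + d * n) + (- d) * n
          cancel = solve-∀

  residue-gap : ∀ {r r'} (d : ℤ) → r < N → r' < N → + r' ≡ + r + d * + N → d ≡ 0ℤ
  residue-gap (+ zero)    _   _    _ = refl
  residue-gap {r} {r'} (+ suc m) _ r'<N e = ⊥-elim (ℕP.<⇒≱ r'<N N≤r')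
    where
    r'≡ : r' ≡ r ℕ.+ suc m ℕ.* N
    r'≡ = ℤP.+-injective (trans e (trans (cong (λ z → + r + z) (sym (ℤP.pos-* (suc m) N)))
                                        (sym (ℤP.pos-+ r _))))
    N≤r' : N ≤ r'
    N≤r' = subst (N ≤_) (sym r'≡) (ℕP.≤-trans (ℕP.m≤m+n N (m ℕ.* N)) (ℕP.m≤n+m _ r))
  residue-gap {r} {r'} -[1+ m ] r<N r'<N e
    with () ← residue-gap (+ suc m) r'<N r<N (swap-sides (+ r') (+ r) -[1+ m ] e)

  at-injective : ∀ {r r' q q'} → at r q ≡ at r' q' → r ≡ r' × q ≡ q'
  at-injective {r} {r'} {q} {q'} e = FinP.toℕ-injective (ℤP.+-injective r≡r') , q≡q'
    where
    rearrange : ∀ a a' q q' → 1ℤ + a + q * + N ≡ 1ℤ + a' + q' * + N → a' ≡ a + (q - q') * + N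
    rearrange a a' q q' e = begin
      a'                                   ≡⟨ unfold a' q' (+ N) ⟩
      (1ℤ + a' + q' * + N) - 1ℤ - q' * + N ≡⟨ cong (λ z → z - 1ℤ - q' * + N) (sym e) ⟩
      (1ℤ + a + q * + N) - 1ℤ - q' * + N   ≡⟨ collect a q q' (+ N) ⟩
      a + (q - q') * + N                   ∎
      where unfold : ∀ a q n → a ≡ (1ℤ + a + q * n) - 1ℤ - q * n
            unfold = solve-∀
            collect : ∀ a q q' n → (1ℤ + a + q * n) - 1ℤ - q' * n ≡ a + (q - q') * n
            collect = solve-∀
    gap : + toℕ r' ≡ + toℕ r + (q - q') * + N
    gap = rearrange (+ toℕ r) (+ toℕ r') q q' e
    shift-zero : q - q' ≡ 0ℤ
    shift-zero = residue-gap (q - q') (FinP.toℕ<n r) (FinP.toℕ<n r') gap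
    q≡q' : q ≡ q'
    q≡q' = ℤP.i-j≡0⇒i≡j q q' shift-zero
    r≡r' : + toℕ r ≡ + toℕ r'
    r≡r' = sym (begin
      + toℕ r'                      ≡⟨ gap ⟩
      + toℕ r + (q - q') * + N      ≡⟨ cong (λ d → + toℕ r + d * + N) shift-zero ⟩
      + toℕ r + 0ℤ                  ≡⟨ ℤP.+-identityʳ _ ⟩
      + toℕ r                       ∎)

  ext-at : ∀ F r q → ext F (at r q) ≡ F r + q * + N
  ext-at F r q with at-injective {q = period (at r q)} {q' = q} (sym (decompose (at r q)))
  ... | r≡ , q≡ = cong₂ (λ r' q' → F r' + q' * + N) r≡ q≡

  at-elim : ∀ {p} (P : ℤ → Set p) → (∀ r q → P (at r q)) → ∀ x → P x
  at-elim P h x = subst P (sym (decompose x)) (h (residue x) (period x))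

  at-next : ∀ r q → at r q + + N ≡ at r (q + 1ℤ)
  at-next r q = next (+ toℕ r) q (+ N)
    where next : ∀ a q n → 1ℤ + a + q * n + n ≡ 1ℤ + a + (q + 1ℤ) * n
          next = solve-∀

  ext-cong : ∀ {F F'} → (∀ r → F r ≡ F' r) → ∀ x → ext F x ≡ ext F' x
  ext-cong e x = cong (_+ period x * + N) (e (residue x))

  ext-periodic : ∀ F x → ext F (x + + N) ≡ ext F x + + N
  ext-periodic F = at-elim (λ x → ext F (x + + N) ≡ ext F x + + N) λ r q → begin
    ext F (at r q + + N)        ≡⟨ cong (ext F) (at-next r q) ⟩
    ext F (at r (q + 1ℤ))       ≡⟨ ext-at F r (q + 1ℤ) ⟩
    F r + (q + 1ℤ) * + N        ≡⟨ split (F r) q (+ N) ⟩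
    F r + q * + N + + N         ≡⟨ cong (_+ + N) (sym (ext-at F r q)) ⟩
    ext F (at r q) + + N        ∎
    where split : ∀ a q n → a + (q + 1ℤ) * n ≡ a + q * n + n
          split = solve-∀

  lift : (Fin N → Fin N) → ℤ → ℤ
  lift π = ext (λ r → + suc (toℕ (π r)))

  lift-periodic : ∀ π x → lift π (x + + N) ≡ lift π x + + N
  lift-periodic π = ext-periodic (λ r → + suc (toℕ (π r)))

  lift-at : ∀ π r q → lift π (at r q) ≡ at (π r) q
  lift-at π r q = ext-at (λ r → + suc (toℕ (π r))) r q

  lift-inverse : ∀ π π' → (∀ r → π (π' r) ≡ r) → ∀ x → lift π (lift π' x) ≡ x
  lift-inverse π π' inv = at-elim (λ x → lift π (lift π' x) ≡ x) λ r q → begin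
    lift π (lift π' (at r q))  ≡⟨ cong (lift π) (lift-at π' r q) ⟩
    lift π (at (π' r) q)       ≡⟨ lift-at π (π' r) q ⟩
    at (π (π' r)) q            ≡⟨ cong (λ r' → at r' q) (inv r) ⟩
    at r q                     ∎

  -- The first two periods, where all inversions of our permutations live.
  at-zero : ∀ r → at r 0ℤ ≡ + suc (toℕ r)
  at-zero r = ℤP.+-identityʳ (+ suc (toℕ r))

  at-one : ∀ r → at r 1ℤ ≡ + suc (N ℕ.+ toℕ r)
  at-one r = begin
    + suc (toℕ r) + 1ℤ * + N    ≡⟨ cong (λ z → + suc (toℕ r) + z) (ℤP.*-identityˡ (+ N)) ⟩
    + suc (toℕ r) + + N         ≡⟨ cong +_ (cong suc (ℕP.+-comm (toℕ r) N)) ⟩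
    + suc (N ℕ.+ toℕ r)         ∎

  ext-zero : ∀ F r → ext F (+ suc (toℕ r)) ≡ F r
  ext-zero F r = begin
    ext F (+ suc (toℕ r))   ≡⟨ cong (ext F) (sym (at-zero r)) ⟩
    ext F (at r 0ℤ)         ≡⟨ ext-at F r 0ℤ ⟩
    F r + 0ℤ                ≡⟨ ℤP.+-identityʳ (F r) ⟩
    F r                     ∎

  ext-one : ∀ F r → ext F (+ suc (N ℕ.+ toℕ r)) ≡ F r + + N
  ext-one F r = begin
    ext F (+ suc (N ℕ.+ toℕ r))   ≡⟨ cong (ext F) (sym (at-one r)) ⟩
    ext F (at r 1ℤ)               ≡⟨ ext-at F r 1ℤ ⟩
    F r + 1ℤ * + N                ≡⟨ cong (λ z → F r + z) (ℤP.*-identityˡ (+ N)) ⟩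
    F r + + N                     ∎

  at-shift : ∀ r s q k → toℕ r ℕ.+ k ≡ toℕ s → at r q + + k ≡ at s q
  at-shift r s q k e = begin
    at r q + + k                          ≡⟨ regroup (+ toℕ r) q (+ k) (+ N) ⟩
    1ℤ + (+ toℕ r + + k) + q * + N        ≡⟨ cong (λ z → 1ℤ + z + q * + N) (trans (sym (ℤP.pos-+ (toℕ r) k)) (cong +_ e)) ⟩
    at s q                                ∎
    where regroup : ∀ a q k n → 1ℤ + a + q * n + k ≡ 1ℤ + (a + k) + q * n
          regroup = solve-∀

  at-wrap : ∀ r s q k → toℕ r ℕ.+ k ≡ N ℕ.+ toℕ s → at r q + + k ≡ at s (q + 1ℤ)
  at-wrap r s q k e = begin
    at r q + + k                          ≡⟨ regroup (+ toℕ r) q (+ k) (+ N) ⟩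
    1ℤ + (+ toℕ r + + k) + q * + N        ≡⟨ cong (λ z → 1ℤ + z + q * + N) (trans (sym (ℤP.pos-+ (toℕ r) k)) (trans (cong +_ e) (ℤP.pos-+ N (toℕ s)))) ⟩
    1ℤ + (+ N + + toℕ s) + q * + N        ≡⟨ carry (+ toℕ s) q (+ N) ⟩
    at s (q + 1ℤ)                         ∎
    where regroup : ∀ a q k n → 1ℤ + a + q * n + k ≡ 1ℤ + (a + k) + q * n
          regroup = solve-∀
          carry : ∀ a q n → 1ℤ + (n + a) + q * n ≡ 1ℤ + a + (q + 1ℤ) * n
          carry = solve-∀

  lift-zero : ∀ π r → lift π (+ suc (toℕ r)) ≡ + suc (toℕ (π r))
  lift-zero π r = ext-zero (λ r → + suc (toℕ (π r))) r

-- Length of a periodic extension f of F : Fin N → ℕ (N = 2n) whose values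
-- spread by at most 2N.  An inversion (i , j) then has j in the first or
-- second period after i's, so
--   ℓ(f) = #{x < y : F y < F x} + #{(x , y) : F y + N < F x}.
module InversionCount (n : ℕ) .{{_ : NonZero (2 ℕ.* n)}} (F : Fin (2 ℕ.* n) → ℕ)
    (spread : ∀ x y → F x ≤ F y ℕ.+ (2 ℕ.* n ℕ.+ 2 ℕ.* n)) where

  open import Data.Nat using (_≤?_)
  open import Data.Integer as ℤ using (ℤ; +_; -[1+_]; _+_; _*_; -_; 1ℤ; +<+)
  import Data.Integer.Properties as ℤP
  open import Data.Integer.Tactic.RingSolver using (solve-∀)
  open import Data.Fin using (_↑ˡ_; _↑ʳ_)
  open import Data.List using (List; allFin; filter; length; cartesianProductWith)
  open import Data.List.Membership.Propositional using (_∈_)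
  open import Data.List.Membership.Propositional.Properties
    using (∈-filter⁺; ∈-filter⁻; ∈-allFin; ∈-cartesianProductWith⁺)
  open import Data.List.Relation.Unary.Unique.Propositional using (Unique)
  import Data.List.Relation.Unary.Unique.Propositional.Properties as Unique
  open import Function.Bundles using (mk⇔)
  open Counting

  N : ℕ
  N = 2 ℕ.* n

  open Periodic N

  F⁺ : Fin N → ℤ
  F⁺ r = + F r

  f : ℤ → ℤ
  f = ext F⁺

  -- inversions (x+1 , y+1) and (x+1 , y+1+N)
  within across : Fin N → Fin N → ℕ
  within x y = 𝕀 (toℕ x <? toℕ y ×-dec F y <? F x)
  across x y = 𝕀 (F y ℕ.+ N <? F x)

  inversion? : Decidable (Inversion n f)
  inversion? (i , j) = 1 ≤? i ×-dec i ≤? N ×-dec + i ℤP.<? j ×-dec f j ℤP.<? f (+ i)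

  pair : Fin N → Fin (N ℕ.+ N) → ℕ × ℤ
  pair x y = suc (toℕ x) , + suc (toℕ y)

  candidates inversions : List (ℕ × ℤ)
  candidates = cartesianProductWith pair (allFin N) (allFin (N ℕ.+ N))
  inversions = filter inversion? candidates

  inversions-unique : Unique inversions
  inversions-unique = Unique.filter⁺ inversion?
    (Unique.cartesianProductWith⁺ pair pair-injective (Unique.allFin⁺ N) (Unique.allFin⁺ (N ℕ.+ N)))
    where
    pair-injective : ∀ {x x' y y'} → pair x y ≡ pair x' y' → x ≡ x' × y ≡ y'
    pair-injective e = FinP.toℕ-injective (ℕP.suc-injective (cong proj₁ e))
                     , FinP.toℕ-injective (ℕP.suc-injective (ℤP.+-injective (cong proj₂ e)))

  -- An inversion starting at x+1 ends at j = at r q with q ∈ {0, 1}: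
  -- q < 0 would put j before i, and q ≥ 2 would make f j ≥ F r + 2N ≥ F x.
  second-index : ∀ x r q → Inversion n f (suc (toℕ x) , at r q) →
                 Σ (Fin (N ℕ.+ N)) λ y → at r q ≡ + suc (toℕ y)
  second-index x r (+ 0) _ =
    r ↑ˡ N , trans (at-zero r) (cong (λ k → + suc k) (sym (FinP.toℕ-↑ˡ r N)))
  second-index x r (+ 1) _ =
    N ↑ʳ r , trans (at-one r) (cong (λ k → + suc k) (sym (FinP.toℕ-↑ʳ N r)))
  second-index x r (+ suc (suc k)) (_ , _ , _ , fj<fi) = ⊥-elim (ℕP.<⇒≱ Fx>far Fx≤far)
    where
    far = F r ℕ.+ suc (suc k) ℕ.* N
    Fx>far : far < F x
    Fx>far = ℤP.drop‿+<+ (subst₂ ℤ._<_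
      (trans (ext-at F⁺ r (+ suc (suc k)))
             (trans (cong (λ z → + F r + z) (sym (ℤP.pos-* (suc (suc k)) N))) (sym (ℤP.pos-+ (F r) _))))
      (ext-zero F⁺ x) fj<fi)
    Fx≤far : F x ≤ far
    Fx≤far = ℕP.≤-trans (spread x r) (ℕP.+-monoʳ-≤ (F r)
               (subst (_≤ suc (suc k) ℕ.* N) (cong (N ℕ.+_) (ℕP.+-identityʳ N))
                      (ℕP.*-monoˡ-≤ N {2} {suc (suc k)} (s≤s (s≤s z≤n)))))
  second-index x r -[1+ k ] (_ , _ , i<j , _) = ⊥-elim (ℕP.<⇒≱ i+back<r (ℕP.≤-trans r<N back≤i+back))
    where
    back = suc k ℕ.* N
    j+back : at r -[1+ k ] + + back ≡ + suc (toℕ r)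
    j+back = trans (cong (λ z → at r -[1+ k ] + z) (ℤP.pos-* (suc k) N)) (cancel (+ toℕ r) (+ suc k) (+ N))
      where cancel : ∀ a q n → 1ℤ + a + (- q) * n + q * n ≡ 1ℤ + a
            cancel = solve-∀
    i+back<r : suc (toℕ x) ℕ.+ back < suc (toℕ r)
    i+back<r = ℤP.drop‿+<+ (subst₂ ℤ._<_ (sym (ℤP.pos-+ (suc (toℕ x)) back)) j+back (ℤP.+-monoˡ-< (+ back) i<j))
    r<N : suc (toℕ r) ≤ N
    r<N = FinP.toℕ<n r
    back≤i+back : N ≤ suc (toℕ x) ℕ.+ back
    back≤i+back = ℕP.≤-trans (ℕP.m≤m+n N (k ℕ.* N)) (ℕP.m≤n+m back (suc (toℕ x)))

  complete : ∀ p → Inversion n f p → p ∈ inversions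
  complete (zero , j) (() , _)
  complete (suc i , j) inv@(_ , i<N , _) =
    ∈-filter⁺ inversion? (subst (λ k → (suc k , j) ∈ candidates) (FinP.toℕ-fromℕ< i<N) (candidate j inv')) inv
    where
    x = fromℕ< i<N
    inv' : Inversion n f (suc (toℕ x) , j)
    inv' = subst (λ k → Inversion n f (suc k , j)) (sym (FinP.toℕ-fromℕ< i<N)) inv
    candidate : ∀ j → Inversion n f (suc (toℕ x) , j) → (suc (toℕ x) , j) ∈ candidates
    candidate = at-elim _ λ r q inv →
      let (y , j≡y) = second-index x r q inv
      in subst (λ j → (suc (toℕ x) , j) ∈ candidates) (sym j≡y)
               (∈-cartesianProductWith⁺ pair (∈-allFin x) (∈-allFin y))

  sound : ∀ p → p ∈ inversions → Inversion n f p
  sound p p∈ = proj₂ (∈-filter⁻ inversion? {xs = candidates} p∈)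

  within-eq : ∀ x y → 𝕀 (inversion? (pair x (y ↑ˡ N))) ≡ within x y
  within-eq x y rewrite FinP.toℕ-↑ˡ y N = 𝕀-cong to from _ _
    where
    to : Inversion n f (suc (toℕ x) , + suc (toℕ y)) → toℕ x < toℕ y × F y < F x
    to (_ , _ , +<+ x<y , fy<fx) =
      ℕP.≤-pred x<y , ℤP.drop‿+<+ (subst₂ ℤ._<_ (ext-zero F⁺ y) (ext-zero F⁺ x) fy<fx)
    from : toℕ x < toℕ y × F y < F x → Inversion n f (suc (toℕ x) , + suc (toℕ y))
    from (x<y , Fy<Fx) = s≤s z≤n , FinP.toℕ<n x , +<+ (s≤s x<y)
                       , subst₂ ℤ._<_ (sym (ext-zero F⁺ y)) (sym (ext-zero F⁺ x)) (+<+ Fy<Fx)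

  across-eq : ∀ x y → 𝕀 (inversion? (pair x (N ↑ʳ y))) ≡ across x y
  across-eq x y rewrite FinP.toℕ-↑ʳ N y = 𝕀-cong to from _ _
    where
    fj : f (+ suc (N ℕ.+ toℕ y)) ≡ + (F y ℕ.+ N)
    fj = trans (ext-one F⁺ y) (sym (ℤP.pos-+ (F y) N))
    to : Inversion n f (suc (toℕ x) , + suc (N ℕ.+ toℕ y)) → F y ℕ.+ N < F x
    to (_ , _ , _ , fy<fx) = ℤP.drop‿+<+ (subst₂ ℤ._<_ fj (ext-zero F⁺ x) fy<fx)
    from : F y ℕ.+ N < F x → Inversion n f (suc (toℕ x) , + suc (N ℕ.+ toℕ y))
    from Fy<Fx = s≤s z≤n , FinP.toℕ<n x
               , +<+ (s≤s (ℕP.<-≤-trans (FinP.toℕ<n x) (ℕP.m≤m+n N (toℕ y))))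
               , subst₂ ℤ._<_ (sym fj) (sym (ext-zero F⁺ x)) (+<+ Fy<Fx)

  count : length inversions ≡ ∑[ x < N ] ∑[ y < N ] within x y ℕ.+ ∑[ x < N ] ∑[ y < N ] across x y
  count = begin
    length inversions
      ≡⟨ count-product inversion? pair (λ x → x) (λ y → y) ⟩
    ∑[ x < N ] ∑[ y < N ℕ.+ N ] 𝕀 (inversion? (pair x y))
      ≡⟨ sum-cong-≗ (λ x → ∑-split N N (λ y → 𝕀 (inversion? (pair x y)))) ⟩
    ∑[ x < N ] (∑[ y < N ] 𝕀 (inversion? (pair x (y ↑ˡ N))) ℕ.+ ∑[ y < N ] 𝕀 (inversion? (pair x (N ↑ʳ y))))
      ≡⟨ sum-cong-≗ (λ x → cong₂ ℕ._+_ (sum-cong-≗ (within-eq x)) (sum-cong-≗ (across-eq x))) ⟩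
    ∑[ x < N ] (∑[ y < N ] within x y ℕ.+ ∑[ y < N ] across x y)
      ≡⟨ ∑-distrib-+ (λ x → ∑[ y < N ] within x y) (λ x → ∑[ y < N ] across x y) ⟩
    ∑[ x < N ] ∑[ y < N ] within x y ℕ.+ ∑[ x < N ] ∑[ y < N ] across x y ∎

  length-ext : HasLength n f (∑[ x < N ] ∑[ y < N ] within x y ℕ.+ ∑[ x < N ] ∑[ y < N ] across x y)
  length-ext = inversions , inversions-unique , (λ p → mk⇔ (sound p) (complete p)) , count

module Lengths where

  open import Data.Integer as ℤ using (+_)
  open import Data.List using ([])
  import Data.List.Relation.Unary.AllPairs as AllPairs
  open import Function.Bundles using (mk⇔; Equivalence)

  HasLength-resp : ∀ {n f f' k} → (∀ x → f x ≡ f' x) → HasLength n f k → HasLength n f' k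
  HasLength-resp {n} {f} {f'} e (L , unique , members , len) =
    L , unique , (λ p → mk⇔ (λ p∈ → transport (Equivalence.to (members p) p∈))
                            (λ inv → Equivalence.from (members p) (transport' inv))) , len
    where
    transport : ∀ {p} → Inversion n f p → Inversion n f' p
    transport {i , j} (1≤i , i≤N , i<j , fj<fi) = 1≤i , i≤N , i<j , subst₂ ℤ._<_ (e j) (e (+ i)) fj<fi
    transport' : ∀ {p} → Inversion n f' p → Inversion n f p
    transport' {i , j} (1≤i , i≤N , i<j , fj<fi) = 1≤i , i≤N , i<j , subst₂ ℤ._<_ (sym (e j)) (sym (e (+ i))) fj<fi

  no-inversions : ∀ f → HasLength 0 f 0
  no-inversions f = [] , AllPairs.[] , (λ p → mk⇔ (λ ()) λ { (s≤s _ , () , _) }) , refl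

  identity : AffineS0 0
  identity = record
    { w = λ x → x ; winv = λ x → x ; w∘winv = λ _ → refl ; winv∘w = λ _ → refl
    ; periodic = λ _ → refl ; sumZero = refl }

-- Relative position of two arcs (a , a') and (b , b') of a matching drawn on
-- a line, each written opener first.
module ArcOrder where

  open import Data.Nat using (_+_)
  open import Data.Nat.Properties
  open import Data.Bool using (if_then_else_)
  open Counting

  nested : ∀ a a' b b' → Dec (a < b × b < b' × b' < a')
  nested a a' b b' = a <? b ×-dec b <? b' ×-dec b' <? a'

  disjoint : ∀ a a' b b' → Dec (a < a' × a' < b × b < b')
  disjoint a a' b b' = a <? a' ×-dec a' <? b ×-dec b <? b'

  crossing : ∀ a a' b b' → Dec (a < b × b < a' × a' < b')
  crossing a a' b b' = a <? b ×-dec b <? a' ×-dec a' <? b'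

  one-order : ∀ y c → y ≢ c → 𝕀 (y <? c) + 𝕀 (c <? y) ≡ 1
  one-order y c y≢c with <-cmp y c
  ... | tri< y<c _ _ = cong₂ _+_ (𝕀-yes (y <? c) y<c) (𝕀-no (c <? y) (<-asym y<c))
  ... | tri≈ _ y≡c _ = ⊥-elim (y≢c y≡c)
  ... | tri> _ _ c<y = cong₂ _+_ (𝕀-no (y <? c) (<-asym c<y)) (𝕀-yes (c <? y) c<y)

  opener-pair-kinds : ∀ a a' b b' → (a' ≡ b → b' ≡ a) → (a' ≡ b' → a ≡ b) →
    𝕀 (a <? b ×-dec a <? a' ×-dec b <? b')
      ≡ 𝕀 (nested a a' b b') + 𝕀 (disjoint a a' b b') + 𝕀 (crossing a a' b b')
  opener-pair-kinds a a' b b' partner injective with a <? b ×-dec a <? a' ×-dec b <? b'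
  ... | no ¬openers = sym (cong₂ _+_ (cong₂ _+_
        (𝕀-no (nested a a' b b') λ (ab , bb' , b'a') → ¬openers (ab , <-trans ab (<-trans bb' b'a') , bb'))
        (𝕀-no (disjoint a a' b b') λ (aa' , a'b , bb') → ¬openers (<-trans aa' a'b , aa' , bb')))
        (𝕀-no (crossing a a' b b') λ (ab , ba' , a'b') → ¬openers (ab , <-trans ab ba' , <-trans ba' a'b')))
  ... | yes (ab , aa' , bb') with <-cmp a' b
  ...   | tri< a'b _ _ = sym (cong₂ _+_ (cong₂ _+_
          (𝕀-no (nested a a' b b') λ (_ , _ , b'a') → <-asym b'a' (<-trans a'b bb'))
          (𝕀-yes (disjoint a a' b b') (aa' , a'b , bb')))
          (𝕀-no (crossing a a' b b') λ (_ , ba' , _) → <-asym ba' a'b))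
  ...   | tri≈ _ a'≡b _ = ⊥-elim (<-irrefl (sym (partner a'≡b)) (<-trans ab bb'))
  ...   | tri> _ _ ba' with <-cmp a' b'
  ...     | tri< a'b' _ _ = sym (cong₂ _+_ (cong₂ _+_
            (𝕀-no (nested a a' b b') λ (_ , _ , b'a') → <-asym b'a' a'b')
            (𝕀-no (disjoint a a' b b') λ (_ , a'b , _) → <-asym a'b ba'))
            (𝕀-yes (crossing a a' b b') (ab , ba' , a'b')))
  ...     | tri≈ _ a'≡b' _ = ⊥-elim (<-irrefl (injective a'≡b') ab)
  ...     | tri> _ _ b'a' = sym (cong₂ _+_ (cong₂ _+_
            (𝕀-yes (nested a a' b b') (ab , bb' , b'a'))
            (𝕀-no (disjoint a a' b b') λ (_ , a'b , _) → <-asym a'b ba'))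
            (𝕀-no (crossing a a' b b') λ (_ , _ , a'b') → <-asym a'b' b'a'))

  -- The order in which the labelling of Section 5 lists two positions a, b
  -- (partners a', b'): openers by position, then closers by position of
  -- their partners, every opener before every closer.
  LabelBefore : ℕ → ℕ → ℕ → ℕ → Set
  LabelBefore a a' b b' = (a < a' × b < b' × a < b) ⊎ (a' < a × b' < b × a' < b') ⊎ (a < a' × b' < b)

  label-before? : ∀ a a' b b' → Dec (LabelBefore a a' b b')
  label-before? a a' b b' = (a <? a' ×-dec b <? b' ×-dec a <? b)
                        ⊎-dec (a' <? a ×-dec b' <? b ×-dec a' <? b') ⊎-dec (a <? a' ×-dec b' <? b)

  -- A label-inversion (a labelled before b, but b < a) is a nested pair of
  -- closers or an opener lying right of a whole arc.
  label-inversion-kinds : ∀ a a' b b' →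
    𝕀 (label-before? a a' b b' ×-dec b <? a) ≡ 𝕀 (nested a' a b' b) + 𝕀 (disjoint b' b a a')
  label-inversion-kinds a a' b b' with label-before? a a' b b' ×-dec b <? a
  ... | no ¬inv = sym (cong₂ _+_
        (𝕀-no (nested a' a b' b) λ (a'b' , b'b , ba) →
           ¬inv (inj₂ (inj₁ (<-trans a'b' (<-trans b'b ba) , b'b , a'b')) , ba))
        (𝕀-no (disjoint b' b a a') λ (b'b , ba , aa') → ¬inv (inj₂ (inj₂ (aa' , b'b)) , ba)))
  ... | yes (inj₁ (_ , _ , ab) , ba) = ⊥-elim (<-asym ab ba)
  ... | yes (inj₂ (inj₁ (a'a , b'b , a'b')) , ba) = sym (cong₂ _+_
        (𝕀-yes (nested a' a b' b) (a'b' , b'b , ba))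
        (𝕀-no (disjoint b' b a a') λ (_ , _ , aa') → <-asym aa' a'a))
  ... | yes (inj₂ (inj₂ (aa' , b'b)) , ba) = sym (cong₂ _+_
        (𝕀-no (nested a' a b' b) λ (a'b' , _ , _) → <-asym a'b' (<-trans b'b (<-trans ba aa')))
        (𝕀-yes (disjoint b' b a a') (b'b , ba , aa')))

  -- 1-based value of g_τ at position x with partner c (0-based, N = 2n).
  gbase : ℕ → ℕ → ℕ → ℕ
  gbase N x c = if ⌊ x <? c ⌋ then suc c else suc c + N

  gbase-opener : ∀ N x c → x < c → gbase N x c ≡ suc c
  gbase-opener N x c x<c with x <? c
  ... | yes _  = refl
  ... | no x≮c = ⊥-elim (x≮c x<c)

  gbase-closer : ∀ N x c → c < x → gbase N x c ≡ suc c + N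
  gbase-closer N x c c<x with x <? c
  ... | yes x<c = ⊥-elim (<-asym x<c c<x)
  ... | no _    = refl

  -- Inversions (x , y) of g_τ with both indices in [2n]: a nested pair of
  -- openers, a nested pair of closers, or a closer followed by an opener
  -- of a later arc.
  g-within-kinds : ∀ N x c y d → x ≢ c → y ≢ d → c < N → d < N →
    𝕀 (x <? y ×-dec gbase N y d <? gbase N x c)
      ≡ 𝕀 (nested x c y d) + 𝕀 (nested d y c x) + 𝕀 (disjoint c x y d)
  g-within-kinds N x c y d x≢c y≢d c<N d<N with <-cmp x c | <-cmp y d
  ... | tri≈ _ x≡c _ | _ = ⊥-elim (x≢c x≡c)
  ... | _ | tri≈ _ y≡d _ = ⊥-elim (y≢d y≡d)
  ... | tri< x<c _ _ | tri< y<d _ _ rewrite gbase-opener N x c x<c | gbase-opener N y d y<d =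
    begin
      𝕀 (x <? y ×-dec suc d <? suc c)
        ≡⟨ 𝕀-cong (λ (x<y , d<c) → x<y , y<d , ≤-pred d<c) (λ (x<y , _ , d<c) → x<y , s≤s d<c) _ _ ⟩
      𝕀 (nested x c y d)
        ≡⟨ sym (trans (+-identityʳ _) (+-identityʳ _)) ⟩
      𝕀 (nested x c y d) + 0 + 0
        ≡⟨ cong₂ (λ u v → 𝕀 (nested x c y d) + u + v)
                 (sym (𝕀-no (nested d y c x) λ (_ , c<x , _) → <-asym c<x x<c))
                 (sym (𝕀-no (disjoint c x y d) λ (c<x , _ , _) → <-asym c<x x<c)) ⟩
      𝕀 (nested x c y d) + 𝕀 (nested d y c x) + 𝕀 (disjoint c x y d) ∎
  ... | tri> _ _ c<x | tri> _ _ d<y rewrite gbase-closer N x c c<x | gbase-closer N y d d<y =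
    begin
      𝕀 (x <? y ×-dec suc d + N <? suc c + N)
        ≡⟨ 𝕀-cong (λ (x<y , dN<cN) → ≤-pred (+-cancelʳ-< N (suc d) (suc c) dN<cN) , c<x , x<y)
                  (λ (d<c , _ , x<y) → x<y , +-monoˡ-< N (s≤s d<c)) _ _ ⟩
      𝕀 (nested d y c x)
        ≡⟨ sym (+-identityʳ _) ⟩
      𝕀 (nested d y c x) + 0
        ≡⟨ cong₂ (λ u v → u + 𝕀 (nested d y c x) + v)
                 (sym (𝕀-no (nested x c y d) λ (_ , y<d , _) → <-asym y<d d<y))
                 (sym (𝕀-no (disjoint c x y d) λ (_ , _ , y<d) → <-asym y<d d<y)) ⟩
      𝕀 (nested x c y d) + 𝕀 (nested d y c x) + 𝕀 (disjoint c x y d) ∎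
  ... | tri< x<c _ _ | tri> _ _ d<y rewrite gbase-opener N x c x<c | gbase-closer N y d d<y =
    begin
      𝕀 (x <? y ×-dec suc d + N <? suc c)
        ≡⟨ 𝕀-no (x <? y ×-dec suc d + N <? suc c)
                (λ (_ , dN<c) → <⇒≱ dN<c (≤-trans c<N (m≤n+m N (suc d)))) ⟩
      0
        ≡⟨ sym (cong₂ _+_ (cong₂ _+_ (𝕀-no (nested x c y d) λ (_ , y<d , _) → <-asym y<d d<y)
                                     (𝕀-no (nested d y c x) λ (_ , c<x , _) → <-asym c<x x<c))
                          (𝕀-no (disjoint c x y d) λ (c<x , _ , _) → <-asym c<x x<c)) ⟩
      𝕀 (nested x c y d) + 𝕀 (nested d y c x) + 𝕀 (disjoint c x y d) ∎
  ... | tri> _ _ c<x | tri< y<d _ _ rewrite gbase-closer N x c c<x | gbase-opener N y d y<d =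
    begin
      𝕀 (x <? y ×-dec suc d <? suc c + N)
        ≡⟨ 𝕀-cong (λ (x<y , _) → c<x , x<y , y<d) (λ (_ , x<y , _) → x<y , s≤s (≤-trans d<N (m≤n+m N c))) _ _ ⟩
      𝕀 (disjoint c x y d)
        ≡⟨ cong₂ (λ u v → u + v + 𝕀 (disjoint c x y d))
                 (sym (𝕀-no (nested x c y d) λ (x<y , _ , d<c) → <-asym d<c (<-trans c<x (<-trans x<y y<d))))
                 (sym (𝕀-no (nested d y c x) λ (d<c , _ , x<y) → <-asym d<c (<-trans c<x (<-trans x<y y<d)))) ⟩
      𝕀 (nested x c y d) + 𝕀 (nested d y c x) + 𝕀 (disjoint c x y d) ∎

  -- Inversions (x , y + 2n) of g_τ: x is a closer lying right of the arc of y.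
  g-across-kinds : ∀ N x c y d → x ≢ c → y ≢ d → c < N →
    𝕀 (gbase N y d + N <? gbase N x c) ≡ 𝕀 (disjoint y d c x)
  g-across-kinds N x c y d x≢c y≢d c<N with <-cmp x c
  ... | tri≈ _ x≡c _ = ⊥-elim (x≢c x≡c)
  ... | tri< x<c _ _ rewrite gbase-opener N x c x<c =
    trans (𝕀-no (gbase N y d + N <? suc c) λ lt → <⇒≱ lt (≤-trans c<N (m≤n+m N (gbase N y d))))
          (sym (𝕀-no (disjoint y d c x) λ (_ , _ , c<x) → <-asym c<x x<c))
  ... | tri> _ _ c<x with <-cmp y d
  ...   | tri< y<d _ _ rewrite gbase-closer N x c c<x | gbase-opener N y d y<d =
    𝕀-cong (λ dN<cN → y<d , ≤-pred (+-cancelʳ-< N (suc d) (suc c) dN<cN) , c<x)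
           (λ (_ , d<c , _) → +-monoˡ-< N (s≤s d<c)) _ _
  ...   | tri≈ _ y≡d _ = ⊥-elim (y≢d y≡d)
  ...   | tri> _ _ d<y rewrite gbase-closer N x c c<x | gbase-closer N y d d<y =
    trans (𝕀-no (suc d + N + N <? suc c + N)
                λ lt → <⇒≱ (+-cancelʳ-< N (suc d + N) (suc c) lt) (≤-trans c<N (m≤n+m N (suc d))))
          (sym (𝕀-no (disjoint y d c x) λ (y<d , _) → <-asym y<d d<y))

module Arcs (n : ℕ) (m : PerfectMatching n) where

  open import Data.Nat using (_+_; _*_)
  open import Data.Nat.Properties
  open import Data.Nat.Combinatorics using (_C_)
  open import Data.Nat.ListAction using () renaming (sum to listSum)
  open import Data.Bool using (_∧_)
  open import Data.List using (allFin; map)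
  open Counting
  open ArcOrder

  N : ℕ
  N = 2 * n

  t : Fin N → Fin N
  t = τ m

  T : Fin N → ℕ
  T a = toℕ (t a)

  T-invol : ∀ a → T (t a) ≡ toℕ a
  T-invol a = cong toℕ (invol m a)

  t-injective : ∀ {a b} → t a ≡ t b → a ≡ b
  t-injective {a} {b} e = trans (sym (invol m a)) (trans (cong t e) (invol m b))

  T-apart : ∀ a → toℕ a ≢ T a
  T-apart a e = noFix m a (sym (FinP.toℕ-injective e))

  Opener : Fin N → Set
  Opener a = toℕ a < T a

  opener? : Decidable Opener
  opener? a = toℕ a <? T a

  closer-after : ∀ a → ¬ Opener a → T a < toℕ a
  closer-after a ¬o with <-cmp (T a) (toℕ a)
  ... | tri< Ta<a _ _ = Ta<a
  ... | tri≈ _ Ta≡a _ = ⊥-elim (T-apart a (sym Ta≡a))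
  ... | tri> _ _ a<Ta = ⊥-elim (¬o a<Ta)

  closer-partner : ∀ a → ¬ Opener a → Opener (t a)
  closer-partner a ¬o = subst (T a <_) (sym (T-invol a)) (closer-after a ¬o)

  opener-partner : ∀ a → Opener a → ¬ Opener (t a)
  opener-partner a o o' = <-asym o (subst (T a <_) (T-invol a) o')

  ∑₂ : (Fin N → Fin N → ℕ) → ℕ
  ∑₂ f = ∑[ a < N ] ∑[ b < N ] f a b

  ∑₂-cong : ∀ {f g} → (∀ a b → f a b ≡ g a b) → ∑₂ f ≡ ∑₂ g
  ∑₂-cong e = sum-cong-≗ (λ a → sum-cong-≗ (e a))

  ∑₂-+ : ∀ f g → ∑₂ (λ a b → f a b + g a b) ≡ ∑₂ f + ∑₂ g
  ∑₂-+ f g = trans (sum-cong-≗ (λ a → ∑-distrib-+ (f a) (g a))) (∑-distrib-+ (λ a → sum (f a)) (λ a → sum (g a)))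

  ∑₂-swap : ∀ f → ∑₂ (λ a b → f b a) ≡ ∑₂ f
  ∑₂-swap f = ∑-comm (λ a b → f b a)

  ∑-partner : ∀ (f : Fin N → ℕ) → ∑[ a < N ] f (t a) ≡ sum f
  ∑-partner f = ∑-reindex f t t (invol m) (invol m)

  ∑₂-partner₁ : ∀ f → ∑₂ (λ a b → f (t a) b) ≡ ∑₂ f
  ∑₂-partner₁ f = ∑-partner (λ a → sum (f a))

  ∑₂-partner₂ : ∀ f → ∑₂ (λ a b → f a (t b)) ≡ ∑₂ f
  ∑₂-partner₂ f = sum-cong-≗ (λ a → ∑-partner (f a))

  Nest Disj Cross : Fin N → Fin N → ℕ
  Nest  a b = 𝕀 (nested   (toℕ a) (T a) (toℕ b) (T b))
  Disj  a b = 𝕀 (disjoint (toℕ a) (T a) (toℕ b) (T b))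
  Cross a b = 𝕀 (crossing (toℕ a) (T a) (toℕ b) (T b))

  nests disjoints crosses : ℕ
  nests     = ∑₂ Nest
  disjoints = ∑₂ Disj
  crosses   = ∑₂ Cross

  crossings≡crosses : crossings m ≡ crosses
  crossings≡crosses =
    trans (listSum-allFin (λ a → listSum (map (crossing-bit a) (allFin N))))
          (sum-cong-≗ (λ a → trans (listSum-allFin (crossing-bit a))
                                   (sum-cong-≗ (λ b → bits (toℕ a <? toℕ b) (toℕ b <? T a) (T a <? T b)))))
    where
    crossing-bit : Fin N → Fin N → ℕ
    crossing-bit a b = bool→ℕ (⌊ toℕ a <? toℕ b ⌋ ∧ ⌊ toℕ b <? T a ⌋ ∧ ⌊ T a <? T b ⌋)
    bits : ∀ {A B C : Set} (p : Dec A) (q : Dec B) (r : Dec C) →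
           bool→ℕ (⌊ p ⌋ ∧ ⌊ q ⌋ ∧ ⌊ r ⌋) ≡ 𝕀 (p ×-dec q ×-dec r)
    bits (yes _) (yes _) (yes _) = refl
    bits (yes _) (yes _) (no _)  = refl
    bits (yes _) (no _)  _       = refl
    bits (no _)  _       _       = refl

  openers : ℕ
  openers = ∑[ a < N ] 𝕀 (opener? a)

  -- Each arc has exactly one opener: openers and closers are in bijection
  -- via t, and together fill [2n].
  openers≡n : openers ≡ n
  openers≡n = *-cancelˡ-≡ openers n 2 (begin
    2 * openers                                          ≡⟨ cong (openers +_) (+-identityʳ openers) ⟩
    openers + openers                                    ≡⟨ cong (openers +_) (sym (∑-partner (λ a → 𝕀 (opener? a)))) ⟩
    openers + ∑[ a < N ] 𝕀 (opener? (t a))               ≡⟨ cong (openers +_) (sum-cong-≗ partner-opens) ⟩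
    openers + ∑[ a < N ] 𝕀 (T a <? toℕ a)                ≡⟨ sym (∑-distrib-+ (λ a → 𝕀 (opener? a)) _) ⟩
    ∑[ a < N ] (𝕀 (opener? a) + 𝕀 (T a <? toℕ a))        ≡⟨ sum-cong-≗ (λ a → one-order (toℕ a) (T a) (T-apart a)) ⟩
    ∑[ a < N ] 1                                         ≡⟨ ∑-const N 1 ⟩
    N * 1                                                ≡⟨ *-identityʳ N ⟩
    2 * n                                                ∎)
    where
    partner-opens : ∀ a → 𝕀 (opener? (t a)) ≡ 𝕀 (T a <? toℕ a)
    partner-opens a = 𝕀-cong (subst (T a <_) (T-invol a)) (subst (T a <_) (sym (T-invol a))) _ _

  -- Pairs of arcs, i.e. pairs of openers a < b, are of exactly one kind.
  n-choose-2 : n C 2 ≡ nests + disjoints + crosses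
  n-choose-2 = begin
    n C 2                                                          ≡⟨ cong (_C 2) (sym openers≡n) ⟩
    openers C 2                                                    ≡⟨ sym (pairs-count opener?) ⟩
    ∑₂ (λ a b → 𝕀 (toℕ a <? toℕ b ×-dec opener? a ×-dec opener? b)) ≡⟨ ∑₂-cong kinds ⟩
    ∑₂ (λ a b → Nest a b + Disj a b + Cross a b)                   ≡⟨ ∑₂-+ _ Cross ⟩
    ∑₂ (λ a b → Nest a b + Disj a b) + crosses                     ≡⟨ cong (_+ crosses) (∑₂-+ Nest Disj) ⟩
    nests + disjoints + crosses                                    ∎
    where
    kinds : ∀ a b → 𝕀 (toℕ a <? toℕ b ×-dec opener? a ×-dec opener? b) ≡ Nest a b + Disj a b + Cross a b
    kinds a b = opener-pair-kinds (toℕ a) (T a) (toℕ b) (T b)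
      (λ Ta≡b → trans (cong T (sym (FinP.toℕ-injective Ta≡b))) (T-invol a))
      (λ Ta≡Tb → cong toℕ (t-injective (FinP.toℕ-injective Ta≡Tb)))

-- The labelling that defines w: openers get labels 0 … n-1 in order of
-- position, and the closer of the arc labelled k gets label n + k.
module Labels (n : ℕ) (m : PerfectMatching n) where

  open import Data.Nat using (_+_)
  open import Data.Nat.Properties
  open import Data.Bool using (if_then_else_)
  open Counting
  open ArcOrder
  open Arcs n m

  rank : Fin N → ℕ
  rank x = ∑[ y < N ] 𝕀 (opener? y ×-dec toℕ y <? toℕ x)

  rank-below : ∀ x {Q : Fin N → Set} (Q? : Decidable Q) →
               (∀ y → Opener y → toℕ y < toℕ x → Q y) → Q x → rank x < ∑[ y < N ] 𝕀 (Q? y)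
  rank-below x Q? left Qx = subst (_≤ ∑[ y < N ] 𝕀 (Q? y)) count (∑-mono pointwise)
    where
    count : ∑[ y < N ] (𝕀 (opener? y ×-dec toℕ y <? toℕ x) + 𝕀 (y Fin.≟ x)) ≡ suc (rank x)
    count = trans (∑-distrib-+ _ (λ y → 𝕀 (y Fin.≟ x))) (trans (cong (rank x +_) (∑-delta x)) (+-comm (rank x) 1))
    pointwise : ∀ y → 𝕀 (opener? y ×-dec toℕ y <? toℕ x) + 𝕀 (y Fin.≟ x) ≤ 𝕀 (Q? y)
    pointwise y with y Fin.≟ x
    ... | yes refl = ≤-reflexive (trans (cong (_+ 1) (𝕀-no (opener? y ×-dec toℕ y <? toℕ y) λ (_ , y<y) → <-irrefl refl y<y))
                                        (sym (𝕀-yes (Q? y) Qx)))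
    ... | no _     = subst (_≤ 𝕀 (Q? y)) (sym (+-identityʳ _)) (𝕀-mono (λ (o , y<x) → left y o y<x) _ (Q? y))

  rank-< : ∀ x x' → Opener x → Opener x' → toℕ x < toℕ x' → rank x < rank x'
  rank-< x x' o o' x<x' = rank-below x (λ y → opener? y ×-dec toℕ y <? toℕ x')
                                        (λ y oy y<x → oy , <-trans y<x x<x') (o , x<x')

  rank<n : ∀ x → Opener x → rank x < n
  rank<n x o = subst (rank x <_) openers≡n (rank-below x opener? (λ y oy _ → oy) o)

  rank-reflects-< : ∀ x x' → Opener x → Opener x' → rank x < rank x' → toℕ x < toℕ x'
  rank-reflects-< x x' o o' lt with <-cmp (toℕ x) (toℕ x')
  ... | tri< x<x' _ _ = x<x'
  ... | tri≈ _ x≡x' _ = ⊥-elim (<-irrefl (cong rank (FinP.toℕ-injective x≡x')) lt)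
  ... | tri> _ _ x'<x = ⊥-elim (<-asym lt (rank-< x' x o' o x'<x))

  rank-injective : ∀ x y → Opener x → Opener y → rank x ≡ rank y → x ≡ y
  rank-injective x y ox oy e with <-cmp (toℕ x) (toℕ y)
  ... | tri< x<y _ _ = ⊥-elim (<-irrefl e (rank-< x y ox oy x<y))
  ... | tri≈ _ x≡y _ = FinP.toℕ-injective x≡y
  ... | tri> _ _ y<x = ⊥-elim (<-irrefl (sym e) (rank-< y x oy ox y<x))

  label : Fin N → ℕ
  label x = if ⌊ opener? x ⌋ then rank x else n + rank (t x)

  label-opener : ∀ x → Opener x → label x ≡ rank x
  label-opener x o with opener? x
  ... | yes _ = refl
  ... | no ¬o = ⊥-elim (¬o o)

  label-closer : ∀ x → ¬ Opener x → label x ≡ n + rank (t x)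
  label-closer x ¬o with opener? x
  ... | yes o = ⊥-elim (¬o o)
  ... | no _  = refl

  label-partner-of-opener : ∀ x → Opener x → label (t x) ≡ n + label x
  label-partner-of-opener x o = begin
    label (t x)        ≡⟨ label-closer (t x) (opener-partner x o) ⟩
    n + rank (t (t x)) ≡⟨ cong (λ y → n + rank y) (invol m x) ⟩
    n + rank x         ≡⟨ cong (n +_) (sym (label-opener x o)) ⟩
    n + label x        ∎

  label-of-closer : ∀ x → ¬ Opener x → label x ≡ n + label (t x)
  label-of-closer x ¬o = trans (label-closer x ¬o) (cong (n +_) (sym (label-opener (t x) (closer-partner x ¬o))))

  opener-label<n : ∀ x → Opener x → label x < n
  opener-label<n x o = subst (_< n) (sym (label-opener x o)) (rank<n x o)

  closer-label≥n : ∀ x → ¬ Opener x → n ≤ label x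
  closer-label≥n x ¬o = subst (n ≤_) (sym (label-closer x ¬o)) (m≤m+n n _)

  label-order : ∀ a b → label a < label b → LabelBefore (toℕ a) (T a) (toℕ b) (T b)
  label-order a b lt = by-kind (opener? a) (opener? b)
    where
    by-kind : Dec (Opener a) → Dec (Opener b) → LabelBefore (toℕ a) (T a) (toℕ b) (T b)
    by-kind (yes oa) (yes ob) =
      inj₁ (oa , ob , rank-reflects-< a b oa ob (subst₂ _<_ (label-opener a oa) (label-opener b ob) lt))
    by-kind (no ¬oa) (no ¬ob) = inj₂ (inj₁ (closer-after a ¬oa , closer-after b ¬ob ,
      rank-reflects-< (t a) (t b) (closer-partner a ¬oa) (closer-partner b ¬ob)
        (+-cancelˡ-< n _ _ (subst₂ _<_ (label-closer a ¬oa) (label-closer b ¬ob) lt))))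
    by-kind (yes oa) (no ¬ob) = inj₂ (inj₂ (oa , closer-after b ¬ob))
    by-kind (no ¬oa) (yes ob) = ⊥-elim (<-asym lt (<-≤-trans (opener-label<n b ob) (closer-label≥n a ¬oa)))

  label-order⁻¹ : ∀ a b → LabelBefore (toℕ a) (T a) (toℕ b) (T b) → label a < label b
  label-order⁻¹ a b (inj₁ (oa , ob , a<b)) =
    subst₂ _<_ (sym (label-opener a oa)) (sym (label-opener b ob)) (rank-< a b oa ob a<b)
  label-order⁻¹ a b (inj₂ (inj₁ (Ta<a , Tb<b , Ta<Tb))) =
    subst₂ _<_ (sym (label-closer a ¬oa)) (sym (label-closer b ¬ob))
      (+-monoʳ-< n (rank-< (t a) (t b) (closer-partner a ¬oa) (closer-partner b ¬ob) Ta<Tb))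
    where
    ¬oa = λ (oa : Opener a) → <-asym oa Ta<a
    ¬ob = λ (ob : Opener b) → <-asym ob Tb<b
  label-order⁻¹ a b (inj₂ (inj₂ (oa , Tb<b))) =
    <-≤-trans (opener-label<n a oa) (closer-label≥n b λ ob → <-asym ob Tb<b)

  label<N : ∀ x → label x < N
  label<N x with opener? x
  ... | yes o = <-≤-trans (rank<n x o) (m≤m+n n (n + 0))
  ... | no ¬o = +-monoʳ-< n (<-≤-trans (rank<n (t x) (closer-partner x ¬o)) (m≤m+n n 0))

  label-injective : ∀ a b → label a ≡ label b → a ≡ b
  label-injective a b e = by-kind (opener? a) (opener? b)
    where
    by-kind : Dec (Opener a) → Dec (Opener b) → a ≡ b
    by-kind (yes oa) (yes ob) =
      rank-injective a b oa ob (trans (sym (label-opener a oa)) (trans e (label-opener b ob)))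
    by-kind (no ¬oa) (no ¬ob) = t-injective (rank-injective (t a) (t b) (closer-partner a ¬oa) (closer-partner b ¬ob)
      (+-cancelˡ-≡ n _ _ (trans (sym (label-closer a ¬oa)) (trans e (label-closer b ¬ob)))))
    by-kind (yes oa) (no ¬ob) = ⊥-elim (<-irrefl e (<-≤-trans (opener-label<n a oa) (closer-label≥n b ¬ob)))
    by-kind (no ¬oa) (yes ob) = ⊥-elim (<-irrefl (sym e) (<-≤-trans (opener-label<n b ob) (closer-label≥n a ¬oa)))

  ρ : Fin N → Fin N
  ρ x = fromℕ< (label<N x)

  toℕ-ρ : ∀ x → toℕ (ρ x) ≡ label x
  toℕ-ρ x = FinP.toℕ-fromℕ< (label<N x)

  ρ-injective : ∀ {a b} → ρ a ≡ ρ b → a ≡ b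
  ρ-injective {a} {b} e = label-injective a b (trans (sym (toℕ-ρ a)) (trans (cong toℕ e) (toℕ-ρ b)))

  σ : Fin N → Fin N
  σ r = proj₁ (injective⇒surjective ρ ρ-injective r)

  ρ∘σ : ∀ r → ρ (σ r) ≡ r
  ρ∘σ r = proj₂ (injective⇒surjective ρ ρ-injective r)

  σ∘ρ : ∀ x → σ (ρ x) ≡ x
  σ∘ρ x = ρ-injective (ρ∘σ (ρ x))

  label-σ : ∀ r → label (σ r) ≡ toℕ r
  label-σ r = trans (sym (toℕ-ρ (σ r))) (cong toℕ (ρ∘σ r))

-- The conjugator w for a matching of [2n], n ≥ 1: w(r+1) = σ(r)+1 on the
-- first period, i.e. w lists positions by label.  The hypothesis g-def
-- holds by definition of g (it is refl for n = suc k).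
module Conjugator (n : ℕ) .{{_ : NonZero (2 ℕ.* n)}} (m : PerfectMatching n)
    (g-def : ∀ x → g m x ≡ Periodic.ext (2 ℕ.* n) (gBase m) x) where

  open import Data.Nat.Combinatorics using (_C_)
  open import Data.Nat.ListAction using () renaming (sum to listSum)
  open import Data.Nat.Tactic.RingSolver using () renaming (solve-∀ to ℕ-solve-∀)
  open import Data.Integer as ℤ using (ℤ; +_; _+_; _*_; _-_; 0ℤ; 1ℤ)
  import Data.Integer.Properties as ℤP
  open import Data.Integer.Tactic.RingSolver using (solve-∀)
  open import Data.List using (List; []; _∷_; map; foldr; allFin)
  import Data.List.Properties as ListP
  open Counting
  open ArcOrder
  open Arcs n m
  open Labels n m
  open Periodic N
  open Lengths

  ω ω⁻¹ : ℤ → ℤ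
  ω = lift σ
  ω⁻¹ = lift ρ

  foldr-differences : ∀ {A : Set} (a b : A → ℕ) (xs : List A) →
    foldr _+_ 0ℤ (map (λ x → + a x - + b x) xs) ≡ + listSum (map a xs) - + listSum (map b xs)
  foldr-differences a b []       = refl
  foldr-differences a b (x ∷ xs) = begin
    (+ a x - + b x) + foldr _+_ 0ℤ (map (λ x → + a x - + b x) xs)
      ≡⟨ cong (λ z → (+ a x - + b x) + z) (foldr-differences a b xs) ⟩
    (+ a x - + b x) + (+ listSum (map a xs) - + listSum (map b xs))
      ≡⟨ interchange (+ a x) (+ b x) (+ listSum (map a xs)) (+ listSum (map b xs)) ⟩
    (+ a x + + listSum (map a xs)) - (+ b x + + listSum (map b xs))
      ≡⟨ sym (cong₂ _-_ (ℤP.pos-+ (a x) _) (ℤP.pos-+ (b x) _)) ⟩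
    + listSum (map a (x ∷ xs)) - + listSum (map b (x ∷ xs)) ∎
    where interchange : ∀ p q r s → (p - q) + (r - s) ≡ (p + r) - (q + s)
          interchange = solve-∀

  -- w only permutes the first period, so its displacements cancel.
  displacement-zero : displacementSum n ω ≡ 0ℤ
  displacement-zero = begin
    displacementSum n ω
      ≡⟨ cong (foldr _+_ 0ℤ) (ListP.map-cong (λ i → cong (_- + suc (toℕ i)) (lift-zero σ i)) (allFin N)) ⟩
    foldr _+_ 0ℤ (map (λ i → + suc (toℕ (σ i)) - + suc (toℕ i)) (allFin N))
      ≡⟨ foldr-differences (λ i → suc (toℕ (σ i))) (λ i → suc (toℕ i)) (allFin N) ⟩
    + listSum (map (λ i → suc (toℕ (σ i))) (allFin N)) - + listSum (map (λ i → suc (toℕ i)) (allFin N))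
      ≡⟨ cong₂ (λ u v → + u - + v) (listSum-allFin (λ i → suc (toℕ (σ i)))) (listSum-allFin {N} (λ i → suc (toℕ i))) ⟩
    + ∑[ i < N ] suc (toℕ (σ i)) - + ∑[ i < N ] suc (toℕ i)
      ≡⟨ cong (λ u → + u - + ∑[ i < N ] suc (toℕ i)) (∑-reindex (λ i → suc (toℕ i)) σ ρ σ∘ρ ρ∘σ) ⟩
    + ∑[ i < N ] suc (toℕ i) - + ∑[ i < N ] suc (toℕ i)
      ≡⟨ ℤP.+-inverseʳ (+ ∑[ i < N ] suc (toℕ i)) ⟩
    0ℤ ∎

  conjugator : AffineS0 n
  conjugator = record
    { w        = ω
    ; winv     = ω⁻¹
    ; w∘winv   = lift-inverse σ ρ σ∘ρ
    ; winv∘w   = lift-inverse ρ σ ρ∘σ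
    ; periodic = lift-periodic σ
    ; sumZero  = displacement-zero
    }

  G : Fin N → ℕ
  G r = gbase N (toℕ r) (T r)

  G⁺ : Fin N → ℤ
  G⁺ r = + G r

  g≡ext : ∀ x → g m x ≡ ext G⁺ x
  g≡ext x = trans (g-def x) (ext-cong gBase≡G x)
    where
    gBase≡G : ∀ r → gBase m r ≡ + G r
    gBase≡G r with opener? r
    ... | yes _ = refl
    ... | no _  = refl

  partner-σ : ∀ r → t (σ r) ≡ σ (ρ (t (σ r)))
  partner-σ r = sym (σ∘ρ (t (σ r)))

  partner-label-opener : ∀ r → Opener (σ r) → toℕ r ℕ.+ n ≡ toℕ (ρ (t (σ r)))
  partner-label-opener r o = begin
    toℕ r ℕ.+ n          ≡⟨ ℕP.+-comm (toℕ r) n ⟩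
    n ℕ.+ toℕ r          ≡⟨ cong (n ℕ.+_) (sym (label-σ r)) ⟩
    n ℕ.+ label (σ r)    ≡⟨ sym (label-partner-of-opener (σ r) o) ⟩
    label (t (σ r))      ≡⟨ sym (toℕ-ρ (t (σ r))) ⟩
    toℕ (ρ (t (σ r)))    ∎

  partner-label-closer : ∀ r → ¬ Opener (σ r) → toℕ r ℕ.+ n ≡ N ℕ.+ toℕ (ρ (t (σ r)))
  partner-label-closer r ¬o = begin
    toℕ r ℕ.+ n                        ≡⟨ cong (ℕ._+ n) (sym (label-σ r)) ⟩
    label (σ r) ℕ.+ n                  ≡⟨ cong (ℕ._+ n) (label-of-closer (σ r) ¬o) ⟩
    n ℕ.+ label (t (σ r)) ℕ.+ n        ≡⟨ cong (λ s → n ℕ.+ s ℕ.+ n) (sym (toℕ-ρ (t (σ r)))) ⟩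
    n ℕ.+ toℕ (ρ (t (σ r))) ℕ.+ n      ≡⟨ wrap n (toℕ (ρ (t (σ r)))) ⟩
    N ℕ.+ toℕ (ρ (t (σ r)))            ∎
    where wrap : ∀ n s → n ℕ.+ s ℕ.+ n ≡ 2 ℕ.* n ℕ.+ s
          wrap = ℕ-solve-∀

  -- G ∘ σ = σ ∘ (+ n) on labels, with the carry into the next period.
  G-opener : ∀ r q → Opener (σ r) → ext G⁺ (at (σ r) q) ≡ ω (at r q + + n)
  G-opener r q o = begin
    ext G⁺ (at (σ r) q)         ≡⟨ ext-at G⁺ (σ r) q ⟩
    + G (σ r) + q * + N         ≡⟨ cong (λ v → + v + q * + N) (trans (gbase-opener N _ _ o) (cong (λ x → suc (toℕ x)) (partner-σ r))) ⟩
    at (σ s) q                  ≡⟨ sym (lift-at σ s q) ⟩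
    ω (at s q)                  ≡⟨ cong ω (sym (at-shift r s q n (partner-label-opener r o))) ⟩
    ω (at r q + + n)            ∎
    where s = ρ (t (σ r))

  G-closer : ∀ r q → ¬ Opener (σ r) → ext G⁺ (at (σ r) q) ≡ ω (at r q + + n)
  G-closer r q ¬o = begin
    ext G⁺ (at (σ r) q)                  ≡⟨ ext-at G⁺ (σ r) q ⟩
    + G (σ r) + q * + N                  ≡⟨ cong (λ v → + v + q * + N) (trans (gbase-closer N _ _ (closer-after (σ r) ¬o)) (cong (λ x → suc (toℕ x) ℕ.+ N) (partner-σ r))) ⟩
    + (suc (toℕ (σ s)) ℕ.+ N) + q * + N  ≡⟨ cong (_+ q * + N) (ℤP.pos-+ (suc (toℕ (σ s))) N) ⟩
    + suc (toℕ (σ s)) + + N + q * + N    ≡⟨ swap (+ suc (toℕ (σ s))) (+ N) q ⟩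
    at (σ s) q + + N                     ≡⟨ at-next (σ s) q ⟩
    at (σ s) (q + 1ℤ)                    ≡⟨ sym (lift-at σ s (q + 1ℤ)) ⟩
    ω (at s (q + 1ℤ))                    ≡⟨ cong ω (sym (at-wrap r s q n (partner-label-closer r ¬o))) ⟩
    ω (at r q + + n)                     ∎
    where s = ρ (t (σ r))
          swap : ∀ a b q → a + b + q * b ≡ a + q * b + b
          swap = solve-∀

  conjugation : ∀ x → g m x ≡ ω (g₀ n (ω⁻¹ x))
  conjugation x = begin
    g m x               ≡⟨ cong (g m) (sym (lift-inverse σ ρ σ∘ρ x)) ⟩
    g m (ω (ω⁻¹ x))     ≡⟨ at-elim (λ y → g m (ω y) ≡ ω (y + + n)) step (ω⁻¹ x) ⟩
    ω (ω⁻¹ x + + n)     ∎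
    where
    step : ∀ r q → g m (ω (at r q)) ≡ ω (at r q + + n)
    step r q with opener? (σ r)
    ... | yes o = trans (cong (g m) (lift-at σ r q)) (trans (g≡ext _) (G-opener r q o))
    ... | no ¬o = trans (cong (g m) (lift-at σ r q)) (trans (g≡ext _) (G-closer r q ¬o))

  ∑₂-relabel : ∀ f → ∑₂ (λ a b → f (ρ a) (ρ b)) ≡ ∑₂ f
  ∑₂-relabel f = trans (sum-cong-≗ (λ a → ∑-reindex (f (ρ a)) ρ σ ρ∘σ σ∘ρ))
                       (∑-reindex (λ x → sum (f x)) ρ σ ρ∘σ σ∘ρ)

  ∑₂-zero : ∀ {f} → (∀ a b → f a b ≡ 0) → ∑₂ f ≡ 0
  ∑₂-zero z = trans (∑₂-cong z) (trans (sum-cong-≗ {N} (λ _ → ∑-zero N)) (∑-zero N))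

  -- ℓ(w) = #nested + #disjoint: the inversions of w are the label-inversions.
  spread-ω : ∀ x y → suc (toℕ (σ x)) ≤ suc (toℕ (σ y)) ℕ.+ (N ℕ.+ N)
  spread-ω x y = ℕP.≤-trans (FinP.toℕ<n (σ x)) (ℕP.≤-trans (ℕP.m≤m+n N N) (ℕP.m≤n+m _ (suc (toℕ (σ y)))))

  module Wℓ = InversionCount n (λ r → suc (toℕ (σ r))) spread-ω

  w-within : ∑₂ Wℓ.within ≡ nests ℕ.+ disjoints
  w-within = begin
    ∑₂ Wℓ.within                                              ≡⟨ sym (∑₂-relabel Wℓ.within) ⟩
    ∑₂ (λ a b → Wℓ.within (ρ a) (ρ b))                         ≡⟨ ∑₂-cong label-inversion ⟩
    ∑₂ (λ a b → 𝕀 (label-before? (toℕ a) (T a) (toℕ b) (T b) ×-dec toℕ b <? toℕ a))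
                                                              ≡⟨ ∑₂-cong kinds ⟩
    ∑₂ (λ a b → Nest (t a) (t b) ℕ.+ Disj (t b) a)             ≡⟨ ∑₂-+ (λ a b → Nest (t a) (t b)) (λ a b → Disj (t b) a) ⟩
    ∑₂ (λ a b → Nest (t a) (t b)) ℕ.+ ∑₂ (λ a b → Disj (t b) a)
      ≡⟨ cong₂ ℕ._+_ (trans (∑₂-partner₁ (λ a b → Nest a (t b))) (∑₂-partner₂ Nest))
                     (trans (∑₂-swap (λ a b → Disj (t a) b)) (∑₂-partner₁ Disj)) ⟩
    nests ℕ.+ disjoints                                       ∎
    where
    label-inversion : ∀ a b → Wℓ.within (ρ a) (ρ b)
                            ≡ 𝕀 (label-before? (toℕ a) (T a) (toℕ b) (T b) ×-dec toℕ b <? toℕ a)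
    label-inversion a b = 𝕀-cong
      (λ (lt , s) → label-order a b (subst₂ _<_ (toℕ-ρ a) (toℕ-ρ b) lt)
                  , subst₂ _<_ (cong toℕ (σ∘ρ b)) (cong toℕ (σ∘ρ a)) (ℕP.≤-pred s))
      (λ (L , b<a) → subst₂ _<_ (sym (toℕ-ρ a)) (sym (toℕ-ρ b)) (label-order⁻¹ a b L)
                   , s≤s (subst₂ _<_ (sym (cong toℕ (σ∘ρ b))) (sym (cong toℕ (σ∘ρ a))) b<a))
      _ _
    kinds : ∀ a b → 𝕀 (label-before? (toℕ a) (T a) (toℕ b) (T b) ×-dec toℕ b <? toℕ a)
                  ≡ Nest (t a) (t b) ℕ.+ Disj (t b) a
    kinds a b = trans (label-inversion-kinds (toℕ a) (T a) (toℕ b) (T b))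
      (cong₂ ℕ._+_ (cong₂ (λ u v → 𝕀 (nested (T a) u (T b) v)) (sym (T-invol a)) (sym (T-invol b)))
                   (cong (λ u → 𝕀 (disjoint (T b) u (toℕ a) (T a))) (sym (T-invol b))))

  w-across : ∑₂ Wℓ.across ≡ 0
  w-across = ∑₂-zero λ x y → 𝕀-no (suc (toℕ (σ y)) ℕ.+ N <? suc (toℕ (σ x)))
    λ lt → ℕP.<⇒≱ lt (ℕP.≤-trans (FinP.toℕ<n (σ x)) (ℕP.m≤n+m N (suc (toℕ (σ y)))))

  ℓw : ℕ
  ℓw = nests ℕ.+ disjoints

  w-length : HasLength n ω ℓw
  w-length = subst (HasLength n ω) (trans (cong₂ ℕ._+_ w-within w-across) (ℕP.+-identityʳ _)) Wℓ.length-ext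

  spread-G : ∀ x y → G x ≤ G y ℕ.+ (N ℕ.+ N)
  spread-G x y = ℕP.≤-trans G≤ (ℕP.≤-trans (ℕP.+-monoˡ-≤ N (FinP.toℕ<n (t x))) (ℕP.m≤n+m _ (G y)))
    where
    G≤ : G x ≤ suc (T x) ℕ.+ N
    G≤ with opener? x
    ... | yes _ = ℕP.m≤m+n _ N
    ... | no _  = ℕP.≤-refl

  module Gℓ = InversionCount n G spread-G

  g-within : ∑₂ Gℓ.within ≡ nests ℕ.+ nests ℕ.+ disjoints
  g-within = begin
    ∑₂ Gℓ.within                                                       ≡⟨ ∑₂-cong kinds ⟩
    ∑₂ (λ x y → Nest x y ℕ.+ Nest (t y) (t x) ℕ.+ Disj (t x) y)        ≡⟨ ∑₂-+ (λ x y → Nest x y ℕ.+ Nest (t y) (t x)) (λ x y → Disj (t x) y) ⟩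
    ∑₂ (λ x y → Nest x y ℕ.+ Nest (t y) (t x)) ℕ.+ ∑₂ (λ x y → Disj (t x) y)
      ≡⟨ cong (ℕ._+ ∑₂ (λ x y → Disj (t x) y)) (∑₂-+ Nest (λ x y → Nest (t y) (t x))) ⟩
    nests ℕ.+ ∑₂ (λ x y → Nest (t y) (t x)) ℕ.+ ∑₂ (λ x y → Disj (t x) y)
      ≡⟨ cong₂ (λ u v → nests ℕ.+ u ℕ.+ v)
           (trans (∑₂-swap (λ x y → Nest (t x) (t y))) (trans (∑₂-partner₁ (λ a b → Nest a (t b))) (∑₂-partner₂ Nest)))
           (∑₂-partner₁ Disj) ⟩
    nests ℕ.+ nests ℕ.+ disjoints                                      ∎
    where
    kinds : ∀ x y → Gℓ.within x y ≡ Nest x y ℕ.+ Nest (t y) (t x) ℕ.+ Disj (t x) y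
    kinds x y = trans
      (g-within-kinds N (toℕ x) (T x) (toℕ y) (T y) (T-apart x) (T-apart y) (FinP.toℕ<n (t x)) (FinP.toℕ<n (t y)))
      (cong₂ ℕ._+_ (cong (Nest x y ℕ.+_) (cong₂ (λ u v → 𝕀 (nested (T y) u (T x) v)) (sym (T-invol y)) (sym (T-invol x))))
                   (cong (λ u → 𝕀 (disjoint (T x) u (toℕ y) (T y))) (sym (T-invol x))))

  g-across : ∑₂ Gℓ.across ≡ disjoints
  g-across = begin
    ∑₂ Gℓ.across                      ≡⟨ ∑₂-cong kinds ⟩
    ∑₂ (λ x y → Disj y (t x))         ≡⟨ ∑₂-swap (λ y x → Disj y (t x)) ⟩
    ∑₂ (λ y x → Disj y (t x))         ≡⟨ ∑₂-partner₂ Disj ⟩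
    disjoints                         ∎
    where
    kinds : ∀ x y → Gℓ.across x y ≡ Disj y (t x)
    kinds x y = trans (g-across-kinds N (toℕ x) (T x) (toℕ y) (T y) (T-apart x) (T-apart y) (FinP.toℕ<n (t x)))
                      (cong (λ u → 𝕀 (disjoint (toℕ y) (T y) (T x) u)) (sym (T-invol x)))

  g-length : HasLength n (g m) (2 ℕ.* ℓw)
  g-length = HasLength-resp {n} {Gℓ.f} {g m} (λ x → sym (g≡ext x))
    (subst (HasLength n Gℓ.f) (trans (cong₂ ℕ._+_ g-within g-across) (double nests disjoints)) Gℓ.length-ext)
    where double : ∀ a b → a ℕ.+ a ℕ.+ b ℕ.+ b ≡ 2 ℕ.* (a ℕ.+ b)
          double = ℕ-solve-∀

  length-formula : + ℓw ≡ + (n C 2) - + crossings m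
  length-formula = sym (begin
    + (n C 2) - + crossings m                          ≡⟨ cong₂ (λ u v → + u - + v) n-choose-2 crossings≡crosses ⟩
    + (nests ℕ.+ disjoints ℕ.+ crosses) - + crosses    ≡⟨ cong (_- + crosses) (ℤP.pos-+ (nests ℕ.+ disjoints) crosses) ⟩
    + (nests ℕ.+ disjoints) + + crosses - + crosses    ≡⟨ cancel (+ (nests ℕ.+ disjoints)) (+ crosses) ⟩
    + (nests ℕ.+ disjoints)                            ∎)
    where cancel : ∀ a b → a + b - b ≡ a
          cancel = solve-∀

open import Data.Nat using (_*_)
open import Data.Nat.Combinatorics using (_C_)
open import Data.Integer using (+_; _-_)
import Data.Integer.Properties as ℤP

lemma4p15 : (n : ℕ) (t : PerfectMatching n) →
    Σ (AffineS0 n) λ v → Σ ℕ λ k →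
    (∀ x → g t x ≡ w v (g₀ n (winv v x)))
    × HasLength n (w v) k
    × (+ k ≡ + (n C 2) - + crossings t)
    × HasLength n (g t) (2 * k)
lemma4p15 zero t = identity , 0 , (λ x → sym (ℤP.+-identityʳ x)) , no-inversions _ , refl , no-inversions (g t)
  where open Lengths
lemma4p15 (suc k) t = conjugator , ℓw , conjugation , w-length , length-formula , g-length
  where open Conjugator (suc k) t (λ x → refl)
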